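{- Let $G$ be a dag, $P$ a dag, $T$ a dag tree decomposition of $P$, and $B$ a bag of $T$ with children $B_1,\dots,B_l$. Fix a homomorphism $\phi_B:P(B)\to G$. Let $\Phi(\phi_B)$ be the set of homomorphisms $P(\overline{B})\to G$ that respect $\phi_B$, and for $i=1,\dots,l$ let $\Phi_i(\phi_B)$ be the set of homomorphisms $P(\overline{B_i})\to G$ that respect $\phi_B$. Then there is a bijection between $\Phi(\phi_B)$ and $\Phi_1(\phi_B)\times\cdots\times\Phi_l(\phi_B)$, and therefore $\hom(P(\overline{B}),G,\phi_B)=\prod_{i=1}^l\hom(P(\overline{B_i}),G,\phi_B)$.
   Context: For a dag $P$: $S_P$ its sources; $V_P(u)$ the set of nodes reachable from $u$ (including $u$); for $B\subseteq S_P$, $V_P(B)=\bigcup_{u\in B}V_P(u)$ and $P(B)$ is the subgraph of $P$ induced by $V_P(B)$. A dag tree decomposition of $P$ is a rooted tree whose nodes (bags) are subsets of $S_P$ with union $S_P$, such that whenever bag $B$ lies on the tree path between bags $B_1,B_2$, $V_P(B_1)\cap V_P(B_2)\subseteq V_P(B)$. For a bag $B$, $\overline{B}$ is the union of all bags in the subtree rooted at $B$. Homomorphisms between dags preserve arc directions. Homomorphisms $\phi_1:P_1\to G$, $\phi_2:P_2\to G$ from subgraphs of $P$ respect each other if they agree on $V_{P_1}\cap V_{P_2}$; $\hom(P_1,G,\phi_2)$ is the number of homomorphisms $P_1\to G$ respecting $\phi_2$. -}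

module Defs where

import Level
open import Data.Nat using (ℕ; zero; suc; _*_)
open import Data.Fin using (Fin; zero; suc)
open import Data.Fin.Subset using (Subset; _∈_)
open import Data.Bool using (Bool; T)
open import Data.Maybe using (Maybe; just; nothing)
open import Data.Product using (Σ; ∃; ∃-syntax; _×_; _,_; proj₁)
open import Data.Sum using (_⊎_)
open import Relation.Nullary using (¬_)
open import Relation.Binary.PropositionalEquality as ≡ using (_≡_; _≗_)
open import Relation.Binary.Bundles using (Setoid)
open import Function.Bundles using (Inverse)
open import Function.Definitions using (Injective)

data Reach {n : ℕ} (arc : Fin n → Fin n → Bool) : Fin n → Fin n → Set where
  here : ∀ {u} → Reach arc u u
  step : ∀ {u w v} → T (arc u w) → Reach arc w v → Reach arc u v

record Dag : Set where
  field
    size    : ℕ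
    arc     : Fin size → Fin size → Bool
    acyclic : ∀ u w → T (arc u w) → ¬ Reach arc w u

open Dag public

IsSource : (P : Dag) → Fin (size P) → Set
IsSource P u = ∀ w → ¬ T (arc P w u)

Vnode : (P : Dag) → Fin (size P) → Fin (size P) → Set
Vnode P u v = Reach (arc P) u v

Vset : (P : Dag) → (Fin (size P) → Set) → Fin (size P) → Set
Vset P B v = ∃[ u ] (B u × Vnode P u v)

-- A map V(P(X)) → V(G) is encoded as f : Fin |P| → Maybe (Fin |G|),
-- defined (just) exactly on X and undefined (nothing) outside X.

IsHom : (P G : Dag) → (Fin (size P) → Set) → (Fin (size P) → Maybe (Fin (size G))) → Set
IsHom P G X f =
  (∀ v → X v → ∃[ a ] (f v ≡ just a)) ×
  (∀ v → ¬ X v → f v ≡ nothing) ×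
  (∀ u v a b → X u → X v → T (arc P u v) → f u ≡ just a → f v ≡ just b → T (arc G a b))

Respects : (P G : Dag) → (Fin (size P) → Set) → (Fin (size P) → Maybe (Fin (size G))) →
           (Fin (size P) → Set) → (Fin (size P) → Maybe (Fin (size G))) → Set
Respects P G X₁ f₁ X₂ f₂ = ∀ v → X₁ v → X₂ v → f₁ v ≡ f₂ v

HomResp : (P G : Dag) → (X₁ : Fin (size P) → Set) →
          (X₂ : Fin (size P) → Set) → (Fin (size P) → Maybe (Fin (size G))) → Setoid Level.zero Level.zero
HomResp P G X₁ X₂ f₂ = record
  { Carrier = Σ (Fin (size P) → Maybe (Fin (size G)))
                (λ f → IsHom P G X₁ f × Respects P G X₁ f X₂ f₂)
  ; _≈_ = λ x y → proj₁ x ≗ proj₁ y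
  ; isEquivalence = record
      { refl = λ _ → ≡.refl
      ; sym = λ p v → ≡.sym (p v)
      ; trans = λ p q v → ≡.trans (p v) (q v) }
  }

ΠSetoid : (l : ℕ) → (Fin l → Setoid Level.zero Level.zero) → Setoid Level.zero Level.zero
ΠSetoid l S = record
  { Carrier = (i : Fin l) → Setoid.Carrier (S i)
  ; _≈_ = λ x y → ∀ i → Setoid._≈_ (S i) (x i) (y i)
  ; isEquivalence = record
      { refl = λ i → Setoid.refl (S i)
      ; sym = λ p i → Setoid.sym (S i) (p i)
      ; trans = λ p q i → Setoid.trans (S i) (p i) (q i) }
  }

HasCard : Setoid Level.zero Level.zero → ℕ → Set
HasCard S N = Inverse S (≡.setoid (Fin N))

prodFin : (l : ℕ) → (Fin l → ℕ) → ℕ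
prodFin zero    f = 1
prodFin (suc l) f = f zero * prodFin l (λ i → f (suc i))

data Anc {t : ℕ} (parent : Fin t → Maybe (Fin t)) : Fin t → Fin t → Set where
  self : ∀ {k} → Anc parent k k
  up   : ∀ {j k p} → parent k ≡ just p → Anc parent j p → Anc parent j k

IsRootedTree : (t : ℕ) → (Fin t → Maybe (Fin t)) → Set
IsRootedTree t parent = ∃[ r ] (parent r ≡ nothing × (∀ k → Anc parent r k))

-- w lies on the (unique) tree path between u and v: w is on the way from u or
-- from v up to their lowest common ancestor
OnPath : {t : ℕ} → (Fin t → Maybe (Fin t)) → Fin t → Fin t → Fin t → Set
OnPath parent w u v =
  (Anc parent w u ⊎ Anc parent w v) ×
  (∀ c → Anc parent c u → Anc parent c v → Anc parent c w)

record DagTreeDecomposition (P : Dag) : Set where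
  field
    nbags   : ℕ
    parent  : Fin nbags → Maybe (Fin nbags)
    isTree  : IsRootedTree nbags parent
    bag     : Fin nbags → Subset (size P)
    bags⊆S  : ∀ j u → u ∈ bag j → IsSource P u
    S⊆bags  : ∀ u → IsSource P u → ∃[ j ] (u ∈ bag j)
    pathCond : ∀ w j k v → OnPath parent w j k →
               Vset P (λ u → u ∈ bag j) v → Vset P (λ u → u ∈ bag k) v →
               Vset P (λ u → u ∈ bag w) v

open DagTreeDecomposition public

Vbag : (P : Dag) → (T : DagTreeDecomposition P) → Fin (nbags T) → Fin (size P) → Set
Vbag P T j = Vset P (λ u → u ∈ bag T j)

bagBar : (P : Dag) → (T : DagTreeDecomposition P) → Fin (nbags T) → Fin (size P) → Set
bagBar P T j u = ∃[ k ] (Anc (parent T) j k × u ∈ bag T k)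

VbagBar : (P : Dag) → (T : DagTreeDecomposition P) → Fin (nbags T) → Fin (size P) → Set
VbagBar P T j = Vset P (bagBar P T j)

IsChildEnum : (P : Dag) → (T : DagTreeDecomposition P) → Fin (nbags T) →
              (l : ℕ) → (Fin l → Fin (nbags T)) → Set
IsChildEnum P T b l ch =
  (∀ i → parent T (ch i) ≡ just b) ×
  Injective _≡_ _≡_ ch ×
  (∀ k → parent T k ≡ just b → ∃[ i ] (ch i ≡ k))

module Submission where

-- Write X = V(B̄),
-- Y = V(B) and Xᵢ = V(B̄ᵢ).  The proof rests on four facts about these node sets:
--   (a) Y ⊆ X, Xᵢ ⊆ X and X ⊆ Y ∪ ⋃ᵢ Xᵢ            (the subtree of B is B plus the subtrees of the Bᵢ);
--   (b) Xᵢ ∩ Xⱼ ⊆ Y for i ≠ j                       (B lies on every tree path from B̄ᵢ to B̄ⱼ);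
--   (c) Y and every Xᵢ are closed under arcs of P   (they are sets of reachable nodes);
--   (d) membership in Y and in the Xᵢ is decidable  (P is finite and acyclic).
-- Given such a cover, the general gluing lemma says that restricting a homomorphism
-- X → G to the Xᵢ is a bijection onto families of homomorphisms Xᵢ → G that all
-- respect φ: by (b) and the respect condition the pieces agree on overlaps, by (a)
-- they determine a total map on X, and by (c) every arc of P(X) lies inside Y or
-- inside a single Xᵢ, so the glued map is a homomorphism.  The count follows since
-- a product of setoids of sizes Nᵢ has size ∏ Nᵢ.

open import Defs
open import Data.Nat using (ℕ)
open import Data.Fin using (Fin)
open import Data.Maybe using (Maybe)
open import Data.Product using (_×_)
open import Relation.Binary.PropositionalEquality using (_≡_)
open import Function.Bundles using (Inverse)

import Level
open import Data.Nat using (zero; suc; _≤_)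
open import Data.Nat.Properties using (≤-pred; <-≤-trans; ≤-refl)
open import Data.Fin using (zero; suc)
open import Data.Fin.Properties using (any?; _≟_; *↔×)
open import Data.Fin.Subset using (_∈_)
open import Data.Fin.Subset.Properties using (_∈?_)
open import Data.Fin.Permutation using (↔⇒≡)
open import Data.Bool using (Bool; T)
open import Data.Bool.Properties using (T?)
open import Data.Maybe using (just; nothing)
open import Data.Maybe.Properties using (just-injective)
open import Data.Product using (Σ; ∃-syntax; _,_; proj₁; proj₂)
open import Data.Product.Relation.Binary.Pointwise.NonDependent using (_×ₛ_; Pointwise-≡↔≡)
open import Data.Product.Function.NonDependent.Setoid using (_×-inverse_)
open import Data.Sum using (_⊎_; inj₁; inj₂; [_,_])
open import Data.Empty using (⊥; ⊥-elim)
open import Data.List using (List; _∷_; filter; length; allFin)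
open import Data.List.Properties using (filter-notAll)
open import Data.List.Relation.Unary.Any as Any using ()
open import Data.List.Membership.Propositional using () renaming (_∈_ to _∈ₗ_)
open import Data.List.Membership.Propositional.Properties using (∈-filter⁺; ∈-allFin)
open import Relation.Nullary using (¬_; Dec; yes; no; ¬?)
open import Relation.Nullary.Decidable using (_×-dec_; map′)
open import Relation.Binary.PropositionalEquality using (_≢_; refl; sym; trans; cong; subst; _≗_)
open import Relation.Binary.Bundles using (Setoid)
import Function.Construct.Composition as Compose
import Function.Construct.Symmetry as Symmetry

-- A depth-first search that never revisits a node: `WalkAvoiding xs u v` is a
-- walk from u to v each of whose steps enters a node still in the list xs, which
-- is then removed.  The list shrinks at each step, so this is decidable by
-- recursion on its length; acyclicity makes every walk such a walk, since a walk
-- leaving w never returns to w.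

module DecidableReachability {n : ℕ} (arc : Fin n → Fin n → Bool)
                             (acyclic : ∀ u w → T (arc u w) → ¬ Reach arc w u) where

  open import Data.List.Membership.DecPropositional (_≟_ {n}) using () renaming (_∈?_ to _∈ₗ?_)

  without : Fin n → List (Fin n) → List (Fin n)
  without w = filter (λ y → ¬? (y ≟ w))

  data WalkAvoiding : List (Fin n) → Fin n → Fin n → Set where
    done : ∀ {xs u} → WalkAvoiding xs u u
    move : ∀ {xs u w v} → T (arc u w) → w ∈ₗ xs → WalkAvoiding (without w xs) w v →
           WalkAvoiding xs u v

  walk⇒reach : ∀ {xs u v} → WalkAvoiding xs u v → Reach arc u v
  walk⇒reach done         = here
  walk⇒reach (move a _ r) = step a (walk⇒reach r)

  without-shorter : ∀ k xs w → length xs ≤ suc k → w ∈ₗ xs → length (without w xs) ≤ k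
  without-shorter k xs w len w∈xs =
    ≤-pred (<-≤-trans (filter-notAll (λ y → ¬? (y ≟ w)) xs
                                     (Any.map (λ w≡y y≢w → y≢w (sym w≡y)) w∈xs))
                      len)

  walk? : (k : ℕ) (xs : List (Fin n)) → length xs ≤ k → ∀ u v → Dec (WalkAvoiding xs u v)
  firstStep? : (k : ℕ) (xs : List (Fin n)) → length xs ≤ suc k → ∀ u v w →
               Dec (T (arc u w) × Σ (w ∈ₗ xs) (λ _ → WalkAvoiding (without w xs) w v))

  walk? k xs len u v with u ≟ v
  walk? k       xs len u v | yes refl = yes done
  walk? zero    xs len u v | no u≢v = no λ
    { done → u≢v refl
    ; (move _ w∈xs _) → nothing-left len w∈xs }
    where
      nothing-left : ∀ {ys : List (Fin n)} {w} → length ys ≤ 0 → ¬ w ∈ₗ ys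
      nothing-left {_ ∷ _} () _
  walk? (suc k) xs len u v | no u≢v with any? (firstStep? k xs len u v)
  ... | yes (w , a , w∈xs , r) = yes (move a w∈xs r)
  ... | no ¬first = no λ { done → u≢v refl ; (move a w∈xs r) → ¬first (_ , a , w∈xs , r) }

  firstStep? k xs len u v w with T? (arc u w) | w ∈ₗ? xs
  ... | no ¬a | _      = no λ z → ¬a (proj₁ z)
  ... | yes _ | no w∉xs = no λ z → w∉xs (proj₁ (proj₂ z))
  ... | yes a | yes w∈xs with walk? k (without w xs) (without-shorter k xs w len w∈xs) w v
  ...   | yes r = yes (a , w∈xs , r)
  ...   | no ¬r = no λ z → ¬r (proj₂ (proj₂ z))

  reach⇒walk : ∀ {xs u v} → (∀ x w → T (arc u w) → Reach arc w x → x ∈ₗ xs) →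
               Reach arc u v → WalkAvoiding xs u v
  reach⇒walk below here = done
  reach⇒walk {xs} below (step {w = w} a r) =
    move a (below w w a here) (reach⇒walk below-w r)
    where
      below-w : ∀ x w′ → T (arc w w′) → Reach arc w′ x → x ∈ₗ without w xs
      below-w x w′ a′ r′ =
        ∈-filter⁺ (λ y → ¬? (y ≟ w)) (below x w a (step a′ r′))
                  (λ x≡w → acyclic w w′ a′ (subst (Reach arc w′) x≡w r′))

  reach? : ∀ u v → Dec (Reach arc u v)
  reach? u v = map′ walk⇒reach (reach⇒walk (λ x _ _ _ → ∈-allFin x))
                    (walk? (length (allFin n)) (allFin n) ≤-refl u v)

module RootedTree {t : ℕ} (parent : Fin t → Maybe (Fin t)) (tree : IsRootedTree t parent) where

  root : Fin t
  root = proj₁ tree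

  root-parentless : parent root ≡ nothing
  root-parentless = proj₁ (proj₂ tree)

  root-above : ∀ k → Anc parent root k
  root-above = proj₂ (proj₂ tree)

  Above : Fin t → Fin t → Set
  Above = Anc parent

  just≢nothing : ∀ {A : Set} {a : A} → just a ≢ nothing
  just≢nothing ()

  same-parent : ∀ {y p q} → parent y ≡ just p → parent y ≡ just q → p ≡ q
  same-parent e e′ = just-injective (trans (sym e) e′)

  above-trans : ∀ {j p k} → Above j p → Above p k → Above j k
  above-trans a self     = a
  above-trans a (up q b) = up q (above-trans a b)

  above-parent : ∀ {x y p} → Above x y → parent y ≡ just p → x ≡ y ⊎ Above x p
  above-parent self     _ = inj₁ refl
  above-parent (up q a) e = inj₂ (subst (Above _) (same-parent q e) a)

  comparable : ∀ {c d k} → Above c k → Above d k → Above c d ⊎ Above d c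
  comparable self      a         = inj₂ a
  comparable (up q a)  self      = inj₁ (up q a)
  comparable (up q a)  (up q′ a′) = comparable a (subst (Above _) (same-parent q′ q) a′)

  not-above-parent : ∀ {y p} → parent y ≡ just p → ¬ Above y p
  not-above-parent {y} q = go (root-above y) q
    where
      go : ∀ {y p} → Above root y → parent y ≡ just p → ¬ Above y p
      go self q _ = just≢nothing (trans (sym q) root-parentless)
      go (up q′ ρ) q a with same-parent q q′
      go (up q′ ρ) q self         | refl = go ρ q′ self
      go (up q′ ρ) q (up q″ a″)   | refl = go ρ q″ (above-trans (up q′ self) a″)

  above? : ∀ j k → Dec (Above j k)
  above? j k = go (root-above k)
    where
      go : ∀ {k} → Above root k → Dec (Above j k)
      go {k} ρ with j ≟ k
      go ρ        | yes refl = yes self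
      go self     | no j≢k = no λ
        { self → j≢k refl ; (up q _) → just≢nothing (trans (sym q) root-parentless) }
      go (up q ρ) | no j≢k with go ρ
      ... | yes a = yes (up q a)
      ... | no ¬a = no λ { self → j≢k refl ; (up q′ a) → ¬a (subst (Above j) (same-parent q′ q) a) }

module _ (P : Dag) where

  Vset-closed : ∀ {B : Fin (size P) → Set} {v w} → Vset P B v → T (arc P v w) → Vset P B w
  Vset-closed (u , u∈B , r) a = u , u∈B , extend r a
    where
      extend : ∀ {u v w} → Reach (arc P) u v → T (arc P v w) → Reach (arc P) u w
      extend here       a = step a here
      extend (step a′ r) a = step a′ (extend r a)

  Vset? : (B : Fin (size P) → Set) → (∀ u → Dec (B u)) → ∀ v → Dec (Vset P B v)
  Vset? B B? v = any? (λ u → B? u ×-dec reach? u v)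
    where open DecidableReachability (arc P) (acyclic P)

module Gluing (P G : Dag) (X Y : Fin (size P) → Set) (l : ℕ) (Xs : Fin l → Fin (size P) → Set)
              (Y? : ∀ v → Dec (Y v)) (Xs? : ∀ i v → Dec (Xs i v))
              (Y⊆X : ∀ {v} → Y v → X v) (Xs⊆X : ∀ {i v} → Xs i v → X v)
              (X⊆cover : ∀ {v} → X v → Y v ⊎ ∃[ i ] Xs i v)
              (overlap⊆Y : ∀ {i j v} → i ≢ j → Xs i v → Xs j v → Y v)
              (Y-closed : ∀ {v w} → Y v → T (arc P v w) → Y w)
              (Xs-closed : ∀ {i v w} → Xs i v → T (arc P v w) → Xs i w)
              (φ : Fin (size P) → Maybe (Fin (size G))) (hφ : IsHom P G Y φ) where

  Img : Set
  Img = Maybe (Fin (size G))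

  Whole : Setoid Level.zero Level.zero
  Whole = HomResp P G X Y φ

  Piece : Fin l → Setoid Level.zero Level.zero
  Piece i = HomResp P G (Xs i) Y φ

  Families : Setoid Level.zero Level.zero
  Families = ΠSetoid l Piece

  keepIf : ∀ {A : Set} → Dec A → Img → Img
  keepIf (yes _) m = m
  keepIf (no _)  _ = nothing

  keepIf-yes : ∀ {A : Set} (d : Dec A) {m} → A → keepIf d m ≡ m
  keepIf-yes (yes _) _ = refl
  keepIf-yes (no ¬a) a = ⊥-elim (¬a a)

  keepIf-no : ∀ {A : Set} (d : Dec A) {m} → ¬ A → keepIf d m ≡ nothing
  keepIf-no (yes a) ¬a = ⊥-elim (¬a a)
  keepIf-no (no _)  _  = refl

  restrict : Setoid.Carrier Whole → Setoid.Carrier Families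
  restrict (f , (defined , undefined , preserves) , respects) i =
    f↾ , (defined↾ , (λ v ∉Xᵢ → keepIf-no (Xs? i v) ∉Xᵢ) , preserves↾) , respects↾
    where
      f↾ : Fin (size P) → Img
      f↾ v = keepIf (Xs? i v) (f v)
      agrees : ∀ {v} → Xs i v → f↾ v ≡ f v
      agrees {v} = keepIf-yes (Xs? i v)
      defined↾ : ∀ v → Xs i v → ∃[ a ] (f↾ v ≡ just a)
      defined↾ v x = let (a , e) = defined v (Xs⊆X x) in a , trans (agrees x) e
      preserves↾ : ∀ u v a c → Xs i u → Xs i v → T (arc P u v) →
                   f↾ u ≡ just a → f↾ v ≡ just c → T (arc G a c)
      preserves↾ u v a c xu xv e eu ev =
        preserves u v a c (Xs⊆X xu) (Xs⊆X xv) e (trans (sym (agrees xu)) eu) (trans (sym (agrees xv)) ev)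
      respects↾ : ∀ v → Xs i v → Y v → f↾ v ≡ φ v
      respects↾ v x y = trans (agrees x) (respects v (Xs⊆X x) y)

  InSomePiece : Fin (size P) → Set
  InSomePiece v = ∃[ i ] Xs i v

  inSomePiece? : ∀ v → Dec (InSomePiece v)
  inSomePiece? v = any? (λ i → Xs? i v)

  -- The glued map: φ on Y, the i-th piece on Xᵢ, undefined elsewhere.  It is
  -- defined by cases on arbitrary decisions so that its laws can be proved for all.
  pick : Setoid.Carrier Families → ∀ v → Dec (Y v) → Dec (InSomePiece v) → Img
  pick fs v (yes _) _            = φ v
  pick fs v (no _)  (yes (i , _)) = proj₁ (fs i) v
  pick fs v (no _)  (no _)        = nothing

  pick-Y : ∀ fs {v} → Y v → ∀ d e → pick fs v d e ≡ φ v
  pick-Y fs y (yes _) e = refl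
  pick-Y fs y (no ¬y) e = ⊥-elim (¬y y)

  -- On Xᵢ the glued map is the i-th piece: overlaps with Y or with another piece
  -- lie in Y, where all pieces agree with φ.
  pick-piece : ∀ fs {i v} → Xs i v → ∀ d e → pick fs v d e ≡ proj₁ (fs i) v
  pick-piece fs {i} {v} x (yes y) e = sym (proj₂ (proj₂ (fs i)) v x y)
  pick-piece fs {i} x (no ¬y) (yes (j , xⱼ)) with j ≟ i
  ... | yes refl = refl
  ... | no j≢i   = ⊥-elim (¬y (overlap⊆Y j≢i xⱼ x))
  pick-piece fs {i} x (no ¬y) (no ¬some) = ⊥-elim (¬some (i , x))

  pick-outside : ∀ fs {v} → ¬ X v → ∀ d e → pick fs v d e ≡ nothing
  pick-outside fs ∉X (yes y)        e  = ⊥-elim (∉X (Y⊆X y))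
  pick-outside fs ∉X (no _) (yes (i , x)) = ⊥-elim (∉X (Xs⊆X x))
  pick-outside fs ∉X (no _) (no _)  = refl

  pick-cong : ∀ {fs gs} → Setoid._≈_ Families fs gs → ∀ v d e → pick fs v d e ≡ pick gs v d e
  pick-cong p v (yes _) e            = refl
  pick-cong p v (no _)  (yes (i , _)) = p i v
  pick-cong p v (no _)  (no _)        = refl

  glued : Setoid.Carrier Families → Fin (size P) → Img
  glued fs v = pick fs v (Y? v) (inSomePiece? v)

  -- The glued map is a homomorphism on X respecting φ: every arc of P(X) starts
  -- in Y or in some Xᵢ, and by arc-closure lies entirely inside that set.
  glue : Setoid.Carrier Families → Setoid.Carrier Whole
  glue fs = glued fs , (defined , undefined , preserves) , (λ v _ y → on-Y y)
    where
      on-Y : ∀ {v} → Y v → glued fs v ≡ φ v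
      on-Y {v} y = pick-Y fs y (Y? v) (inSomePiece? v)
      on-piece : ∀ {i v} → Xs i v → glued fs v ≡ proj₁ (fs i) v
      on-piece {v = v} x = pick-piece fs x (Y? v) (inSomePiece? v)
      defined : ∀ v → X v → ∃[ a ] (glued fs v ≡ just a)
      defined v x with X⊆cover x
      ... | inj₁ y = let (a , e) = proj₁ hφ v y in a , trans (on-Y y) e
      ... | inj₂ (i , xᵢ) = let (a , e) = proj₁ (proj₁ (proj₂ (fs i))) v xᵢ in a , trans (on-piece xᵢ) e
      undefined : ∀ v → ¬ X v → glued fs v ≡ nothing
      undefined v ∉X = pick-outside fs ∉X (Y? v) (inSomePiece? v)
      preserves : ∀ u v a c → X u → X v → T (arc P u v) →
                  glued fs u ≡ just a → glued fs v ≡ just c → T (arc G a c)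
      preserves u v a c xu xv e eu ev with X⊆cover xu
      ... | inj₁ yu = let yv = Y-closed yu e in
        proj₂ (proj₂ hφ) u v a c yu yv e (trans (sym (on-Y yu)) eu) (trans (sym (on-Y yv)) ev)
      ... | inj₂ (i , xu) = let xv = Xs-closed xu e in
        proj₂ (proj₂ (proj₁ (proj₂ (fs i)))) u v a c xu xv e
          (trans (sym (on-piece xu)) eu) (trans (sym (on-piece xv)) ev)

  restrict∘glue : ∀ fs i → proj₁ (restrict (glue fs) i) ≗ proj₁ (fs i)
  restrict∘glue fs i v with Xs? i v
  ... | yes x  = pick-piece fs x (Y? v) (inSomePiece? v)
  ... | no ¬x  = sym (proj₁ (proj₂ (proj₁ (proj₂ (fs i)))) v ¬x)

  -- Every point of X lies in Y or in some piece, where restriction keeps f.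
  glue∘restrict : ∀ f → glued (restrict f) ≗ proj₁ f
  glue∘restrict f v = go (Y? v) (inSomePiece? v)
    where
      go : ∀ d e → pick (restrict f) v d e ≡ proj₁ f v
      go (yes y) e             = sym (proj₂ (proj₂ f) v (Y⊆X y) y)
      go (no _) (yes (i , x))  = keepIf-yes (Xs? i v) x
      go (no ¬y) (no ¬some)    = sym (proj₁ (proj₂ (proj₁ (proj₂ f))) v (λ x → [ ¬y , ¬some ] (X⊆cover x)))

  gluing : Inverse Whole Families
  gluing = record
    { to        = restrict
    ; from      = glue
    ; to-cong   = λ p i v → cong (keepIf (Xs? i v)) (p v)
    ; from-cong = λ p v → pick-cong p v (Y? v) (inSomePiece? v)
    ; inverse   = (λ {fs} {f} p i v → trans (cong (keepIf (Xs? i v)) (p v)) (restrict∘glue fs i v))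
                , (λ {f} {fs} p v → trans (pick-cong p v (Y? v) (inSomePiece? v)) (glue∘restrict f v))
    }

ΠSetoid-uncons : ∀ l (S : Fin (suc l) → Setoid Level.zero Level.zero) →
                 Inverse (ΠSetoid (suc l) S) (S zero ×ₛ ΠSetoid l (λ i → S (suc i)))
ΠSetoid-uncons l S = record
  { to        = λ xs → xs zero , (λ i → xs (suc i))
  ; from      = cons
  ; to-cong   = λ p → p zero , (λ i → p (suc i))
  ; from-cong = λ { (p , ps) zero → p ; (p , ps) (suc i) → ps i }
  ; inverse   = (λ { {_ , _} p → p zero , (λ i → p (suc i)) })
              , (λ { {y = _ , _} (p , ps) zero → p ; {y = _ , _} (p , ps) (suc i) → ps i })
  }
  where
    cons : Setoid.Carrier (S zero ×ₛ ΠSetoid l (λ i → S (suc i))) → Setoid.Carrier (ΠSetoid (suc l) S)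
    cons (x , xs) zero    = x
    cons (x , xs) (suc i) = xs i

prod-card : ∀ l (S : Fin l → Setoid Level.zero Level.zero) (Ns : Fin l → ℕ) →
            (∀ i → HasCard (S i) (Ns i)) → HasCard (ΠSetoid l S) (prodFin l Ns)
prod-card zero S Ns _ = record
  { to        = λ _ → zero
  ; from      = λ _ ()
  ; to-cong   = λ _ → refl
  ; from-cong = λ _ ()
  ; inverse   = (λ { {zero} _ → refl }) , (λ _ ())
  }
prod-card (suc l) S Ns cards =
  ΠSetoid-uncons l S
    ⨾ (cards zero ×-inverse prod-card l (λ i → S (suc i)) (λ i → Ns (suc i)) (λ i → cards (suc i)))
    ⨾ Pointwise-≡↔≡
    ⨾ Symmetry.inverse (*↔× {Ns zero} {prodFin l (λ i → Ns (suc i))})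
  where
    infixr 9 _⨾_
    _⨾_ = Compose.inverse

card-unique : ∀ {S R : Setoid Level.zero Level.zero} {N M : ℕ} →
              Inverse S R → HasCard S N → HasCard R M → N ≡ M
card-unique S↔R S↔N R↔M = ↔⇒≡ (Compose.inverse (Symmetry.inverse S↔N) (Compose.inverse S↔R R↔M))

module BagAndChildren (P : Dag) (T : DagTreeDecomposition P) (b : Fin (nbags T))
                      (l : ℕ) (ch : Fin l → Fin (nbags T)) (children : IsChildEnum P T b l ch) where

  open RootedTree (parent T) (isTree T)

  child-parent : ∀ i → parent T (ch i) ≡ just b
  child-parent = proj₁ children

  ch-injective : ∀ {i j} → ch i ≡ ch j → i ≡ j
  ch-injective = proj₁ (proj₂ children)

  b-above-child : ∀ i → Above b (ch i)
  b-above-child i = up (child-parent i) self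

  below-b : ∀ {k} → Above b k → k ≡ b ⊎ ∃[ i ] Above (ch i) k
  below-b self = inj₁ refl
  below-b {k} (up q a) with below-b a
  ... | inj₁ refl = let (i , chi≡k) = proj₂ (proj₂ children) k q
                    in inj₂ (i , subst (Above (ch i)) chi≡k self)
  ... | inj₂ (i , a′) = inj₂ (i , up q a′)

  child-above-child : ∀ {i j} → i ≢ j → Above (ch i) (ch j) → ⊥
  child-above-child {i} {j} i≢j a with above-parent a (child-parent j)
  ... | inj₁ e = i≢j (ch-injective e)
  ... | inj₂ a′ = not-above-parent (child-parent i) a′

  subtrees-disjoint : ∀ {i j k} → i ≢ j → Above (ch i) k → Above (ch j) k → ⊥
  subtrees-disjoint i≢j aᵢ aⱼ with comparable aᵢ aⱼ
  ... | inj₁ a = child-above-child i≢j a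
  ... | inj₂ a = child-above-child (λ j≡i → i≢j (sym j≡i)) a

  common-above-b : ∀ {i j k₁ k₂ c} → i ≢ j → Above (ch i) k₁ → Above (ch j) k₂ →
                   Above c k₁ → Above c k₂ → Above c b
  common-above-b {i} i≢j a₁ a₂ c₁ c₂ with comparable c₁ a₁
  ... | inj₂ chi-above-c = ⊥-elim (subtrees-disjoint i≢j (above-trans chi-above-c c₂) a₂)
  ... | inj₁ c-above-chi with above-parent c-above-chi (child-parent i)
  ...   | inj₁ refl  = ⊥-elim (subtrees-disjoint i≢j c₂ a₂)
  ...   | inj₂ c-above-b = c-above-b

  X Y : Fin (size P) → Set
  X = VbagBar P T b
  Y = Vbag P T b

  Xs : Fin l → Fin (size P) → Set
  Xs i = VbagBar P T (ch i)

  Y⊆X : ∀ {v} → Y v → X v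
  Y⊆X (u , u∈B , r) = u , (b , self , u∈B) , r

  Xs⊆X : ∀ {i v} → Xs i v → X v
  Xs⊆X {i} (u , (k , a , u∈Bₖ) , r) = u , (k , above-trans (b-above-child i) a , u∈Bₖ) , r

  X⊆cover : ∀ {v} → X v → Y v ⊎ ∃[ i ] Xs i v
  X⊆cover (u , (k , a , u∈Bₖ) , r) with below-b a
  ... | inj₁ refl     = inj₁ (u , u∈Bₖ , r)
  ... | inj₂ (i , a′) = inj₂ (i , u , (k , a′ , u∈Bₖ) , r)

  -- b lies on the tree path between any bag below ch i and any bag below ch j,
  -- so the path condition of the decomposition applies.
  overlap⊆Y : ∀ {i j v} → i ≢ j → Xs i v → Xs j v → Y v
  overlap⊆Y {i} {v = v} i≢j (u₁ , (k₁ , a₁ , m₁) , r₁) (u₂ , (k₂ , a₂ , m₂) , r₂) =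
    pathCond T b k₁ k₂ v
      (inj₁ (above-trans (b-above-child i) a₁) , (λ c c₁ c₂ → common-above-b i≢j a₁ a₂ c₁ c₂))
      (u₁ , m₁ , r₁) (u₂ , m₂ , r₂)

  bagBar? : ∀ j u → Dec (bagBar P T j u)
  bagBar? j u = any? (λ k → above? j k ×-dec (u ∈? bag T k))

  Y? : ∀ v → Dec (Y v)
  Y? = Vset? P _ (λ u → u ∈? bag T b)

  Xs? : ∀ i v → Dec (Xs i v)
  Xs? i = Vset? P _ (bagBar? (ch i))

lemmaA2 : (G P : Dag) (T : DagTreeDecomposition P) (b : Fin (nbags T))
    (l : ℕ) (ch : Fin l → Fin (nbags T)) → IsChildEnum P T b l ch →
    (φB : Fin (size P) → Maybe (Fin (size G))) → IsHom P G (Vbag P T b) φB →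
    Inverse (HomResp P G (VbagBar P T b) (Vbag P T b) φB)
    (ΠSetoid l (λ i → HomResp P G (VbagBar P T (ch i)) (Vbag P T b) φB))
    × (∀ (N : ℕ) (Ns : Fin l → ℕ) →
    HasCard (HomResp P G (VbagBar P T b) (Vbag P T b) φB) N →
    (∀ i → HasCard (HomResp P G (VbagBar P T (ch i)) (Vbag P T b) φB) (Ns i)) →
    N ≡ prodFin l Ns)
lemmaA2 G P T b l ch children φB hom =
  bijection , λ N Ns card cards → card-unique bijection card (prod-card l Piece Ns cards)
  where
    open BagAndChildren P T b l ch children
    open Gluing P G X Y l Xs Y? Xs? Y⊆X Xs⊆X X⊆cover overlap⊆Y
                (Vset-closed P) (Vset-closed P) φB hom
                renaming (gluing to bijection)
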